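{- Let $I=(G,\mathcal P,\mathcal Q,\psi)$ be an instance of Synchronized Planarity whose graph $G$ has $m$ edges. Then $\Phi(I)<2m$, where $$\Phi(I)=\sum_{\rho\in\mathcal P_B}\deg^*(\rho)+\sum_{\rho\in\mathcal P_{CC}}\bigl(2\deg^*(\rho)-1\bigr).$$
   Context: An instance of Synchronized Planarity is $(G,\mathcal P,\mathcal Q,\psi)$: $G=(P\cup Q,E)$ is a loop-free multi-graph with P-vertices $P$ and Q-vertices $Q$; $\mathcal Q$ is a partition of $Q$; $\psi$ assigns to each Q-vertex a cyclic order of its incident edges; $\mathcal P$ is a set of pipes $(u,v,\varphi_{uv})$ with $u,v$ P-vertices and $\varphi_{uv}$ a bijection between the edges incident to $u$ and those incident to $v$ (so $\deg(u)=\deg(v)$), where each P-vertex occurs in at most one pipe. For a pipe $\rho=(u,v,\varphi_{uv})$ let $\deg^*(\rho)=\max\{\deg(u)-3,0\}$. $\mathcal P_{CC}$ is the set of pipes both of whose endpoints are cut-vertices of $G$, and $\mathcal P_B=\mathcal P\setminus\mathcal P_{CC}$. Standing assumption of the paper: $G$ has no isolated vertices (and is non-empty). -}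

module Defs where

open import Data.Nat using (ℕ; zero; suc; _∸_; _≥_)
open import Data.Fin using (Fin; _≟_)
open import Data.Fin.Properties using ()
open import Data.Bool using (Bool; true; false)
open import Data.Product using (Σ; ∃; _×_; _,_; proj₁; proj₂)
open import Data.Sum using (_⊎_; inj₁; inj₂)
open import Data.List using (List; filter; length; map; foldr; allFin)
open import Data.List.Relation.Binary.Permutation.Propositional using (_↭_)
open import Data.Integer as ℤ using (ℤ; +_)
open import Function.Bundles using (_⤖_)
open import Relation.Nullary using (¬_; Dec; yes; no)
open import Relation.Nullary.Decidable using (_⊎-dec_)
open import Relation.Binary.PropositionalEquality using (_≡_; _≢_)
open import Relation.Binary.Construct.Closure.ReflexiveTransitive using (Star)
import Data.Fin as F

record MultiGraph (n m : ℕ) : Set where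
  field
    ends     : Fin m → Fin n × Fin n
    loopFree : ∀ e → proj₁ (ends e) ≢ proj₂ (ends e)

module _ {n m : ℕ} (G : MultiGraph n m) where
  open MultiGraph G

  Incident : Fin n → Fin m → Set
  Incident v e = proj₁ (ends e) ≡ v ⊎ proj₂ (ends e) ≡ v

  incident? : (v : Fin n) (e : Fin m) → Dec (Incident v e)
  incident? v e = (proj₁ (ends e) ≟ v) ⊎-dec (proj₂ (ends e) ≟ v)

  incidentEdges : Fin n → List (Fin m)
  incidentEdges v = filter (incident? v) (allFin m)  

  deg : Fin n → ℕ
  deg v = length (incidentEdges v)

  IncEdge : Fin n → Set
  IncEdge v = Σ (Fin m) (Incident v)

  Adj : Fin n → Fin n → Set
  Adj x y = ∃ λ e → ends e ≡ (x , y) ⊎ ends e ≡ (y , x)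

  AdjMinus : Fin n → Fin n → Fin n → Set
  AdjMinus w x y = x ≢ w × y ≢ w × Adj x y

  Connected : Fin n → Fin n → Set
  Connected = Star Adj

  ConnectedMinus : Fin n → Fin n → Fin n → Set
  ConnectedMinus w = Star (AdjMinus w)

  -- w is a cut-vertex: removing w disconnects two vertices that were
  -- connected in G (i.e. G - w has more connected components than G)
  IsCutVertex : Fin n → Set
  IsCutVertex w = ∃ λ x → ∃ λ y →
    x ≢ w × y ≢ w × Connected x y × ¬ ConnectedMinus w x y

record Pipe {n m : ℕ} (G : MultiGraph n m) (isP : Fin n → Bool) : Set where
  field
    u v      : Fin n
    uP       : isP u ≡ true
    vP       : isP v ≡ true
    distinct : u ≢ v
    φ        : IncEdge G u ⤖ IncEdge G v

record SPInstance (n m : ℕ) : Set₁ where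
  field
    G      : MultiGraph n m
    -- isP v ≡ true : v is a P-vertex; false : v is a Q-vertex
    isP    : Fin n → Bool
    -- the partition 𝒬 of Q, given by a class label for each Q-vertex
    qClass : (v : Fin n) → isP v ≡ false → ℕ
    -- ψ: a cyclic order of the incident edges of each Q-vertex,
    -- represented by a list enumerating them (up to rotation)
    ψ      : (v : Fin n) → isP v ≡ false → List (Fin m)
    ψ-perm : (v : Fin n) (q : isP v ≡ false) → ψ v q ↭ incidentEdges G v
    numPipes : ℕ
    pipe     : Fin numPipes → Pipe G isP
    pipesDisjoint : ∀ i j (w : Fin n) →
      (Pipe.u (pipe i) ≡ w ⊎ Pipe.v (pipe i) ≡ w) →
      (Pipe.u (pipe j) ≡ w ⊎ Pipe.v (pipe j) ≡ w) → i ≡ j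

  -- deg*(ρ) = max{deg(u) - 3, 0}
  deg* : Fin numPipes → ℕ
  deg* i = deg G (Pipe.u (pipe i)) ∸ 3

  InPCC : Fin numPipes → Set
  InPCC i = IsCutVertex G (Pipe.u (pipe i)) × IsCutVertex G (Pipe.v (pipe i))

  CorrectCC : (Fin numPipes → Bool) → Set
  CorrectCC cc = ∀ i → (cc i ≡ true → InPCC i) × (InPCC i → cc i ≡ true)

  Φ : (Fin numPipes → Bool) → ℤ
  Φ cc = foldr ℤ._+_ (+ 0) (map term (allFin numPipes))
    where
    term : Fin numPipes → ℤ
    term i with cc i
    ... | true  = (+ 2 ℤ.* + deg* i) ℤ.- + 1
    ... | false = + deg* i

  NoIsolated : Set
  NoIsolated = ∀ w → deg G w ≥ 1

module Submission where

-- A pipe ρ = (u, v, φ) contributes less than 2 deg(u) = deg(u) + deg(v) to Φ: the bijection φ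
-- forces deg(u) = deg(v), and 2 deg*(ρ) - 1 < 2 deg(u) while deg*(ρ) ≤ deg(u) < deg(u) + deg(v).
-- Since the endpoints of distinct pipes are pairwise distinct, the degrees of all pipe endpoints
-- count distinct half-edges, of which there are 2m. With no pipes at all, Φ = 0 < 2m because
-- some vertex exists and is not isolated.

open import Defs
open import Data.Nat using (ℕ; _≥_; _*_)
open import Data.Integer using (_<_; +_)
open import Data.Bool using (Bool)
open import Data.Fin using (Fin)

open import Data.Nat as ℕ using (_+_; _≤_)
import Data.Nat.Properties as ℕ
open import Data.Integer as ℤ using (ℤ)
import Data.Integer.Properties as ℤ
open import Data.Bool using (true; false)
open import Data.Fin using (zero; suc; combine; fromℕ<; _≟_)
import Data.Fin.Properties as Fin
open import Data.List using (List; []; _∷_; _++_; map; foldr; concatMap; lookup; length; allFin)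
open import Data.Nat.ListAction using (sum)
open import Data.Nat.ListAction.Properties using (sum-++)
import Data.List.Properties as List
open import Data.List.Relation.Unary.All as All using (All)
import Data.List.Relation.Unary.All.Properties as All
open import Data.List.Relation.Unary.AllPairs as AllPairs using (_∷_)
import Data.List.Relation.Unary.AllPairs.Properties as AllPairs
open import Data.List.Relation.Unary.Any as Any using (here; there)
open import Data.List.Relation.Unary.Unique.Propositional using (Unique)
import Data.List.Relation.Unary.Unique.Propositional.Properties as Unique
open import Data.List.Relation.Binary.Disjoint.Propositional using (Disjoint)
open import Data.List.Membership.Propositional using (_∈_)
open import Data.List.Membership.Propositional.Properties
  using (∈-lookup; ∈-filter⁻; ∈-filter⁺; ∈-allFin; ∈-map⁻)
import Data.List.Membership.Setoid.Properties as SetoidMembership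
open import Data.Product using (_,_; proj₁; proj₂)
open import Data.Sum using (_⊎_; inj₁; inj₂)
open import Data.Empty using (⊥-elim)
open import Function using (_∘_; Injective)
open import Function.Bundles using (Bijection; _⤖_)
open import Function.Properties.Bijection using (sym-≡)
open import Relation.Binary.PropositionalEquality
open import Relation.Nullary using (yes; no)
open import Axiom.UniquenessOfIdentityProofs using (module Decidable⇒UIP)

private
  variable
    A B : Set

lookup-injective : ∀ {xs : List A} → Unique xs → Injective _≡_ _≡_ (lookup xs)
lookup-injective (_  ∷ _) {zero}  {zero}  _  = refl
lookup-injective (x∉ ∷ _) {zero}  {suc j} eq = ⊥-elim (All.lookup x∉ (∈-lookup j) eq)
lookup-injective (x∉ ∷ _) {suc i} {zero}  eq = ⊥-elim (All.lookup x∉ (∈-lookup i) (sym eq))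
lookup-injective (_  ∷ u) {suc i} {suc j} eq = cong suc (lookup-injective u eq)

index-injective : ∀ {x y : A} {xs} (x∈ : x ∈ xs) (y∈ : y ∈ xs) →
                  Any.index x∈ ≡ Any.index y∈ → x ≡ y
index-injective = SetoidMembership.index-injective (setoid _)

Unique⇒length≤ : ∀ {N} {xs : List (Fin N)} → Unique xs → length xs ≤ N
Unique⇒length≤ u = Fin.injective⇒≤ (lookup-injective u)

Unique-concatMap⁺ : ∀ {f : A → List B} → (∀ x → Unique (f x)) →
                    (∀ {x y} → x ≢ y → Disjoint (f x) (f y)) →
                    ∀ {xs} → Unique xs → Unique (concatMap f xs)
Unique-concatMap⁺ f-unique f-disjoint {xs} u = Unique.concat⁺
  (All.map⁺ (All.universal f-unique xs)) (AllPairs.map⁺ (AllPairs.map f-disjoint u))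

sum-map-concatMap : ∀ (f : B → ℕ) (g : A → List B) xs →
                    sum (map f (concatMap g xs)) ≡ sum (map (sum ∘ map f ∘ g) xs)
sum-map-concatMap f g []       = refl
sum-map-concatMap f g (x ∷ xs) = begin
  sum (map f (g x ++ concatMap g xs))              ≡⟨ cong sum (List.map-++ f (g x) _) ⟩
  sum (map f (g x) ++ map f (concatMap g xs))      ≡⟨ sum-++ (map f (g x)) _ ⟩
  sum (map f (g x)) + sum (map f (concatMap g xs))
    ≡⟨ cong (sum (map f (g x)) ℕ.+_) (sum-map-concatMap f g xs) ⟩
  sum (map f (g x)) + sum (map (sum ∘ map f ∘ g) xs) ∎
  where open ≡-Reasoning

sumℤ : List ℤ → ℤ
sumℤ = foldr ℤ._+_ (+ 0)

sumℤ-map-≤ : ∀ {t : A → ℤ} {g : A → ℕ} → (∀ x → t x ℤ.≤ + g x) →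
             ∀ xs → sumℤ (map t xs) ℤ.≤ + sum (map g xs)
sumℤ-map-≤ t≤g []       = ℤ.≤-refl
sumℤ-map-≤ t≤g (x ∷ xs) = ℤ.+-mono-≤ (t≤g x) (sumℤ-map-≤ t≤g xs)

sumℤ-map-< : ∀ {t : A → ℤ} {g : A → ℕ} {b} → (∀ x → t x < + g x) →
             ∀ xs → 0 ℕ.< b → sum (map g xs) ≤ b → sumℤ (map t xs) < + b
sumℤ-map-< t<g []       0<b _    = ℤ.+<+ 0<b
sumℤ-map-< t<g (x ∷ xs) _   Σg≤b = ℤ.<-≤-trans
  (ℤ.+-mono-<-≤ (t<g x) (sumℤ-map-≤ (ℤ.<⇒≤ ∘ t<g) xs)) (ℤ.+≤+ Σg≤b)

doubled-bound : ∀ {x d} → x ≤ d → + 2 ℤ.* + x ℤ.- + 1 < + (2 * d)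
doubled-bound {x} x≤d rewrite ℤ.+◃n≡+n (2 * x) =
  ℤ.<-≤-trans (ℤ.m⊖1+n<m (2 * x) 1) (ℤ.+≤+ (ℕ.*-monoʳ-≤ 2 x≤d))

single-bound : ∀ {x d} → x ≤ d → 1 ≤ d → + x < + (2 * d)
single-bound {d = d} x≤d 1≤d =
  ℤ.+<+ (ℕ.≤-<-trans x≤d (ℕ.m<m+n d (ℕ.m≤n⇒m≤n+o 0 1≤d)))

module _ {n m : ℕ} (G : MultiGraph n m) where
  open MultiGraph G

  Incident-irrelevant : ∀ {w e} (p q : Incident G w e) → p ≡ q
  Incident-irrelevant         (inj₁ p) (inj₁ q) = cong inj₁ (Decidable⇒UIP.≡-irrelevant _≟_ p q)
  Incident-irrelevant         (inj₂ p) (inj₂ q) = cong inj₂ (Decidable⇒UIP.≡-irrelevant _≟_ p q)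
  Incident-irrelevant {e = e} (inj₁ p) (inj₂ q) = ⊥-elim (loopFree e (trans p (sym q)))
  Incident-irrelevant {e = e} (inj₂ p) (inj₁ q) = ⊥-elim (loopFree e (trans q (sym p)))

  incidentEdges-unique : ∀ w → Unique (incidentEdges G w)
  incidentEdges-unique w = Unique.filter⁺ (incident? G w) (Unique.allFin⁺ m)

  ∈-incidentEdges⁺ : ∀ {w e} → Incident G w e → e ∈ incidentEdges G w
  ∈-incidentEdges⁺ {w} {e} = ∈-filter⁺ (incident? G w) (∈-allFin e)

  ∈-incidentEdges⁻ : ∀ {w e} → e ∈ incidentEdges G w → Incident G w e
  ∈-incidentEdges⁻ {w} = proj₂ ∘ ∈-filter⁻ (incident? G w) {xs = allFin m}

  enumerate : ∀ w → Fin (deg G w) → IncEdge G w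
  enumerate w k = lookup (incidentEdges G w) k , ∈-incidentEdges⁻ (∈-lookup k)

  position : ∀ w → IncEdge G w → Fin (deg G w)
  position w (_ , p) = Any.index (∈-incidentEdges⁺ p)

  enumerate-injective : ∀ w → Injective _≡_ _≡_ (enumerate w)
  enumerate-injective w = lookup-injective (incidentEdges-unique w) ∘ cong proj₁

  position-injective : ∀ w → Injective _≡_ _≡_ (position w)
  position-injective w {e , p} {e′ , p′} eq
    with refl ← index-injective (∈-incidentEdges⁺ p) (∈-incidentEdges⁺ p′) eq
    = cong (e ,_) (Incident-irrelevant p p′)

  deg-mono-injective : ∀ {u v} {f : IncEdge G u → IncEdge G v} →
                       Injective _≡_ _≡_ f → deg G u ≤ deg G v
  deg-mono-injective {u} {v} f-inj = Fin.injective⇒≤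
    (enumerate-injective u ∘ f-inj ∘ position-injective v)

  deg-cong-⤖ : ∀ {u v} → IncEdge G u ⤖ IncEdge G v → deg G u ≡ deg G v
  deg-cong-⤖ φ = ℕ.≤-antisym (deg-mono-injective (Bijection.injective φ))
                              (deg-mono-injective (Bijection.injective (sym-≡ φ)))

  side : Fin m → Fin n → Fin 2
  side e w with proj₁ (ends e) ≟ w
  ... | yes _ = zero
  ... | no  _ = suc zero

  endpoint : Fin m → Fin 2 → Fin n
  endpoint e zero       = proj₁ (ends e)
  endpoint e (suc zero) = proj₂ (ends e)

  endpoint-side : ∀ {w e} → Incident G w e → endpoint e (side e w) ≡ w
  endpoint-side {w} {e} inc with proj₁ (ends e) ≟ w | inc
  ... | yes p  | _      = p
  ... | no  ¬p | inj₁ p = ⊥-elim (¬p p)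
  ... | no  _  | inj₂ q = q

  halfEdge : Fin n → Fin m → Fin (2 * m)
  halfEdge w e = combine (side e w) e

  halfEdge-injectiveʳ : ∀ w → Injective _≡_ _≡_ (halfEdge w)
  halfEdge-injectiveʳ w {e} {e′} = Fin.combine-injectiveʳ (side e w) e (side e′ w) e′

  halfEdge-injectiveˡ : ∀ {w w′ e e′} → Incident G w e → Incident G w′ e′ →
                        halfEdge w e ≡ halfEdge w′ e′ → w ≡ w′
  halfEdge-injectiveˡ {w} {w′} {e} {e′} p p′ eq
    with side≡ , refl ← Fin.combine-injective (side e w) e (side e′ w′) e′ eq = begin
      w                      ≡⟨ endpoint-side p ⟨
      endpoint e (side e w)  ≡⟨ cong (endpoint e) side≡ ⟩
      endpoint e (side e w′) ≡⟨ endpoint-side p′ ⟩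
      w′                     ∎
    where open ≡-Reasoning

  halfEdgesAt : Fin n → List (Fin (2 * m))
  halfEdgesAt w = map (halfEdge w) (incidentEdges G w)

  halfEdgesAt-unique : ∀ w → Unique (halfEdgesAt w)
  halfEdgesAt-unique w = Unique.map⁺ (halfEdge-injectiveʳ w) (incidentEdges-unique w)

  halfEdgesAt-disjoint : ∀ {w w′} → w ≢ w′ → Disjoint (halfEdgesAt w) (halfEdgesAt w′)
  halfEdgesAt-disjoint w≢w′ (x∈ , x∈′)
    with e , e∈ , refl ← ∈-map⁻ (halfEdge _) x∈
       | e′ , e′∈ , eq ← ∈-map⁻ (halfEdge _) x∈′
    = w≢w′ (halfEdge-injectiveˡ (∈-incidentEdges⁻ e∈) (∈-incidentEdges⁻ e′∈) eq)

  length-halfEdges : ∀ ws → length (concatMap halfEdgesAt ws) ≡ sum (map (deg G) ws)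
  length-halfEdges []       = refl
  length-halfEdges (w ∷ ws) = begin
    length (halfEdgesAt w ++ concatMap halfEdgesAt ws)
      ≡⟨ List.length-++ (halfEdgesAt w) ⟩
    length (halfEdgesAt w) + length (concatMap halfEdgesAt ws)
      ≡⟨ cong₂ _+_ (List.length-map (halfEdge w) (incidentEdges G w)) (length-halfEdges ws) ⟩
    deg G w + sum (map (deg G) ws)
      ∎
    where open ≡-Reasoning

  degreeSum-≤ : ∀ {ws} → Unique ws → sum (map (deg G) ws) ≤ 2 * m
  degreeSum-≤ {ws} u = subst (_≤ 2 * m) (length-halfEdges ws)
    (Unique⇒length≤ (Unique-concatMap⁺ halfEdgesAt-unique halfEdgesAt-disjoint u))

module _ {n m : ℕ} (I : SPInstance n m) where
  open SPInstance I

  pipeEnds : Fin numPipes → List (Fin n)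
  pipeEnds i = Pipe.u (pipe i) ∷ Pipe.v (pipe i) ∷ []

  pipeEnds-unique : ∀ i → Unique (pipeEnds i)
  pipeEnds-unique i = (Pipe.distinct (pipe i) All.∷ All.[]) ∷ All.[] ∷ AllPairs.[]

  pipeEnds-disjoint : ∀ {i j} → i ≢ j → Disjoint (pipeEnds i) (pipeEnds j)
  pipeEnds-disjoint {i} {j} i≢j (w∈i , w∈j) =
    i≢j (pipesDisjoint i j _ (∈-pipeEnds⁻ w∈i) (∈-pipeEnds⁻ w∈j))
    where
    ∈-pipeEnds⁻ : ∀ {k w} → w ∈ pipeEnds k → Pipe.u (pipe k) ≡ w ⊎ Pipe.v (pipe k) ≡ w
    ∈-pipeEnds⁻ (here w≡u)         = inj₁ (sym w≡u)
    ∈-pipeEnds⁻ (there (here w≡v)) = inj₂ (sym w≡v)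

  pipeDegree : Fin numPipes → ℕ
  pipeDegree i = sum (map (deg G) (pipeEnds i))

  pipeDegree≡ : ∀ i → pipeDegree i ≡ 2 * deg G (Pipe.u (pipe i))
  pipeDegree≡ i = cong (λ d → deg G (Pipe.u (pipe i)) + (d + 0))
                       (sym (deg-cong-⤖ G (Pipe.φ (pipe i))))

  pipeDegreeSum-≤ : sum (map pipeDegree (allFin numPipes)) ≤ 2 * m
  pipeDegreeSum-≤ = subst (_≤ 2 * m) (sum-map-concatMap (deg G) pipeEnds (allFin numPipes))
    (degreeSum-≤ G (Unique-concatMap⁺ pipeEnds-unique pipeEnds-disjoint (Unique.allFin⁺ numPipes)))

  edges-positive : n ≥ 1 → NoIsolated → 0 ℕ.< 2 * m
  edges-positive n≥1 noIsolated = ℕ.≤-trans (noIsolated w)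
    (subst (_≤ 2 * m) (ℕ.+-identityʳ (deg G w)) (degreeSum-≤ G (All.[] ∷ AllPairs.[])))
    where w = fromℕ< n≥1

mainTheorem11 : (n m : ℕ) (I : SPInstance n m) → n ≥ 1 →
    SPInstance.NoIsolated I →
    (cc : Fin (SPInstance.numPipes I) → Bool) → SPInstance.CorrectCC I cc →
    SPInstance.Φ I cc < + (2 * m)
-- The bound holds for every classification cc.
mainTheorem11 n m I n≥1 noIsolated cc _ =
  sumℤ-map-< termBound (allFin numPipes) (edges-positive I n≥1 noIsolated) (pipeDegreeSum-≤ I)
  where
  open SPInstance I
  -- Φ's summand is local to its definition; Φ-unfold makes unification name it term.
  term : Fin numPipes → ℤ
  term = _
  Φ-unfold : Φ cc ≡ sumℤ (map term (allFin numPipes))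
  Φ-unfold = refl
  deg*≤ : ∀ i → deg* i ≤ deg G (Pipe.u (pipe i))
  deg*≤ i = ℕ.m∸n≤m _ 3
  termBound : ∀ i → term i < + pipeDegree I i
  termBound i rewrite pipeDegree≡ I i with cc i
  ... | true  = doubled-bound (deg*≤ i)
  ... | false = single-bound (deg*≤ i) (noIsolated (Pipe.u (pipe i)))
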